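{- For any two positive integers $l$ and $n$, $a(l n) \geq a(l)\, a(n)$, where $a$ is the number of recursive divisors.
   Context: For positive integers, write $m \lfloor n$ to mean that $m$ is a proper divisor of $n$ (i.e. $m \mid n$ and $m < n$). The number of recursive divisors $a:\mathbb{Z}_{>0}\to\mathbb{Z}_{>0}$ is defined recursively by $a(1)=1$ and $a(n) = 1 + \sum_{m \lfloor n} a(m)$ for $n>1$. -}

module Defs where

open import Data.Nat using (ℕ; zero; suc; _+_; _*_)
open import Data.Nat.Divisibility using (_∣?_)
open import Data.List using (List; []; _∷_; map; filter)
open import Data.Nat.ListAction using (sum)
open import Data.List.Base using (upTo)

properDivisors : ℕ → List ℕ
properDivisors n = filter (_∣? n) (map suc (upTo (n Data.Nat.∸ 1)))

-- recursive definition with fuel; the fuel only ensures structural termination.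
-- recDiv' f n is  1 + Σ_{d proper divisor of n} recDiv' (f-1) d,
-- which equals the paper's a(n) whenever f ≥ n (each proper divisor is < n).
recDiv' : ℕ → ℕ → ℕ
recDiv' zero    n = 1
recDiv' (suc f) n = 1 + sum (map (recDiv' f) (properDivisors n))

a : ℕ → ℕ
a n = recDiv' n n

-- For L, M ≥ 1, every proper divisor of L is a proper divisor of ML, and so is kL for every proper
-- divisor k of M; the first family lies below L and the second does not. Hence, by strong induction on M,
-- a(ML) ≥ 1 + (a(L) − 1) + Σ_{k ⌊ M} a(kL) ≥ a(L) + a(L) (a(M) − 1) = a(L) a(M).
module Submission where

open import Defs
open import Data.Bool using (true; false; if_then_else_)
open import Data.List using ([]; _∷_; map; filter; applyUpTo; upTo)
open import Data.List.Properties using (map-upTo; map-applyUpTo)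
open import Data.Nat using (ℕ; zero; suc; _+_; _*_; _≤_; _<_; _≥_; z≤n; s≤s)
open import Data.Nat.Divisibility using (_∣_; _∣?_; ∣-trans; n∣m*n; *-monoˡ-∣; 0∣⇒≡0)
open import Data.Nat.Induction using (<-rec)
open import Data.Nat.ListAction using (sum)
open import Data.Nat.Properties
open import Function using (_∘_)
open import Relation.Nullary using (¬_; does; yes; no)
open import Relation.Nullary.Decidable using (dec-true; dec-false)
open import Relation.Unary using (Pred; Decidable)
open import Relation.Binary.PropositionalEquality

∑< : ℕ → (ℕ → ℕ) → ℕ
∑< K g = sum (applyUpTo g K)

∑<-cong : ∀ K {g h} → (∀ i → i < K → g i ≡ h i) → ∑< K g ≡ ∑< K h
∑<-cong zero    eq = refl
∑<-cong (suc K) eq = cong₂ _+_ (eq 0 (s≤s z≤n)) (∑<-cong K (λ i i<K → eq (suc i) (s≤s i<K)))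

∑<-mono : ∀ K {g h} → (∀ i → i < K → g i ≤ h i) → ∑< K g ≤ ∑< K h
∑<-mono zero    le = z≤n
∑<-mono (suc K) le = +-mono-≤ (le 0 (s≤s z≤n)) (∑<-mono K (λ i i<K → le (suc i) (s≤s i<K)))

∑<-+ : ∀ A B g → ∑< (A + B) g ≡ ∑< A g + ∑< B (λ i → g (A + i))
∑<-+ zero    B g = refl
∑<-+ (suc A) B g = trans (cong (g 0 +_) (∑<-+ A B (g ∘ suc))) (sym (+-assoc (g 0) _ _))

∑<-*ˡ : ∀ K c g → ∑< K (λ i → c * g i) ≡ c * ∑< K g
∑<-*ˡ zero    c g = sym (*-zeroʳ c)
∑<-*ˡ (suc K) c g = trans (cong (c * g 0 +_) (∑<-*ˡ K c (g ∘ suc))) (sym (*-distribˡ-+ c (g 0) _))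

∑<-multiples : ∀ K n g → ∑< K (λ k → g (k * suc n)) ≤ ∑< (K * suc n) g
∑<-multiples zero    n g = z≤n
∑<-multiples (suc K) n g = begin
  g 0 + ∑< K (λ k → g (suc n + k * suc n))          ≤⟨ +-mono-≤ (m≤m+n (g 0) _) (∑<-multiples K n (λ i → g (suc n + i))) ⟩
  ∑< (suc n) g + ∑< (K * suc n) (λ i → g (suc n + i)) ≡⟨ ∑<-+ (suc n) (K * suc n) g ⟨
  ∑< (suc K * suc n) g                              ∎
  where open ≤-Reasoning

sum-map-filter : ∀ {a p} {A : Set a} {P : Pred A p} (P? : Decidable P) (f : A → ℕ) xs →
                 sum (map f (filter P? xs)) ≡ sum (map (λ x → if does (P? x) then f x else 0) xs)
sum-map-filter P? f []       = refl
sum-map-filter P? f (x ∷ xs) with does (P? x)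
... | true  = cong (f x +_) (sum-map-filter P? f xs)
... | false = sum-map-filter P? f xs

onDivisors : ℕ → (ℕ → ℕ) → ℕ → ℕ
onDivisors N f m = if does (m ∣? N) then f m else 0

onDivisors-∣ : ∀ {N m} f → m ∣ N → onDivisors N f m ≡ f m
onDivisors-∣ {N} {m} f m∣N rewrite dec-true (m ∣? N) m∣N = refl

onDivisors-∤ : ∀ {N m} f → ¬ m ∣ N → onDivisors N f m ≡ 0
onDivisors-∤ {N} {m} f m∤N rewrite dec-false (m ∣? N) m∤N = refl

onDivisors-cong : ∀ N f g m → f m ≡ g m → onDivisors N f m ≡ onDivisors N g m
onDivisors-cong N f g m eq = cong (λ r → if does (m ∣? N) then r else 0) eq

onDivisors-mono : ∀ {N N′} f → N ∣ N′ → ∀ m → onDivisors N f m ≤ onDivisors N′ f m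
onDivisors-mono {N} f N∣N′ m with m ∣? N
... | yes m∣N = ≤-reflexive (sym (onDivisors-∣ f (∣-trans m∣N N∣N′)))
... | no  _   = z≤n

recDiv'-suc : ∀ f n → recDiv' (suc f) (suc n) ≡ suc (∑< n (onDivisors (suc n) (recDiv' f) ∘ suc))
recDiv'-suc f n = cong suc (trans (sum-map-filter (_∣? suc n) (recDiv' f) (map suc (upTo n)))
                                  (cong sum (trans (cong (map _) (map-upTo suc n)) (map-applyUpTo suc _ n))))

recDiv'-fuel : ∀ f g n → n ≤ f → n ≤ g → recDiv' f n ≡ recDiv' g n
recDiv'-fuel zero    zero    n       _   _   = refl
recDiv'-fuel zero    (suc g) zero    _   _   = refl
recDiv'-fuel (suc f) zero    zero    _   _   = refl
recDiv'-fuel (suc f) (suc g) zero    _   _   = refl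
recDiv'-fuel (suc f) (suc g) (suc n) 1+n≤1+f 1+n≤1+g = begin
  recDiv' (suc f) (suc n)                          ≡⟨ recDiv'-suc f n ⟩
  suc (∑< n (onDivisors (suc n) (recDiv' f) ∘ suc)) ≡⟨ cong suc (∑<-cong n fuel-irrelevant) ⟩
  suc (∑< n (onDivisors (suc n) (recDiv' g) ∘ suc)) ≡⟨ recDiv'-suc g n ⟨
  recDiv' (suc g) (suc n)                          ∎
  where
  open ≡-Reasoning
  fuel-irrelevant : ∀ i → i < n → onDivisors (suc n) (recDiv' f) (suc i) ≡ onDivisors (suc n) (recDiv' g) (suc i)
  fuel-irrelevant i i<n = onDivisors-cong (suc n) (recDiv' f) (recDiv' g) (suc i)
    (recDiv'-fuel f g (suc i) (≤-trans i<n (≤-pred 1+n≤1+f)) (≤-trans i<n (≤-pred 1+n≤1+g)))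

a-unfold : ∀ n → a (suc n) ≡ suc (∑< n (onDivisors (suc n) a ∘ suc))
a-unfold n = trans (recDiv'-suc n n) (cong suc (∑<-cong n (λ i i<n →
  onDivisors-cong (suc n) (recDiv' n) a (suc i) (recDiv'-fuel n (suc i) (suc i) i<n ≤-refl))))

a-unfold₀ : ∀ n → a (suc n) ≡ suc (∑< (suc n) (onDivisors (suc n) a))
a-unfold₀ n = trans (a-unfold n)
  (cong (λ z → suc (z + ∑< n (onDivisors (suc n) a ∘ suc))) (sym (onDivisors-∤ {suc n} a (1+n≢0 ∘ 0∣⇒≡0))))

a-superMultiplicative : ∀ l m → a (suc l) * a (suc m) ≤ a (suc m * suc l)
a-superMultiplicative l = <-rec _ step
  where
  L = suc l
  step : ∀ m → (∀ {k} → k < m → a L * a (suc k) ≤ a (suc k * L)) → a L * a (suc m) ≤ a (suc m * L)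
  step zero    _  = ≤-reflexive (trans (*-identityʳ (a L)) (cong a (sym (*-identityˡ L))))
  step (suc m) ih = begin
    a L * a M                                            ≡⟨ cong (a L *_) (a-unfold (suc m)) ⟩
    a L * suc Y                                          ≡⟨ *-suc (a L) Y ⟩
    a L + a L * Y                                        ≡⟨ cong (_+ a L * Y) (a-unfold₀ l) ⟩
    suc (∑< L (onDivisors L a) + a L * Y)                ≤⟨ s≤s (+-mono-≤ divisors-of-L multiples-of-L) ⟩
    suc (∑< L g + ∑< (suc m * L) (λ i → g (L + i)))      ≡⟨ cong suc (∑<-+ L (suc m * L) g) ⟨
    suc (∑< (M * L) g)                                   ≡⟨ a-unfold₀ (l + suc m * L) ⟨
    a (M * L)                                            ∎
    where
    open ≤-Reasoning
    M = suc (suc m)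
    Y = ∑< (suc m) (onDivisors M a ∘ suc)
    g = onDivisors (M * L) a

    divisors-of-L : ∑< L (onDivisors L a) ≤ ∑< L g
    divisors-of-L = ∑<-mono L (λ i _ → onDivisors-mono {L} a (n∣m*n M) i)

    scaled : ∀ k → k < suc m → a L * onDivisors M a (suc k) ≤ g (suc k * L)
    scaled k k<m with suc k ∣? M
    ... | yes k∣M = begin
      a L * onDivisors M a (suc k) ≡⟨ cong (a L *_) (onDivisors-∣ a k∣M) ⟩
      a L * a (suc k)              ≤⟨ ih k<m ⟩
      a (suc k * L)                ≡⟨ onDivisors-∣ a (*-monoˡ-∣ L k∣M) ⟨
      g (suc k * L)                ∎
    ... | no k∤M = begin
      a L * onDivisors M a (suc k) ≡⟨ cong (a L *_) (onDivisors-∤ a k∤M) ⟩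
      a L * 0                      ≡⟨ *-zeroʳ (a L) ⟩
      0                            ≤⟨ z≤n ⟩
      g (suc k * L)                ∎

    multiples-of-L : a L * Y ≤ ∑< (suc m * L) (λ i → g (L + i))
    multiples-of-L = begin
      a L * Y                                          ≡⟨ ∑<-*ˡ (suc m) (a L) (onDivisors M a ∘ suc) ⟨
      ∑< (suc m) (λ k → a L * onDivisors M a (suc k))  ≤⟨ ∑<-mono (suc m) scaled ⟩
      ∑< (suc m) (λ k → g (suc k * L))                 ≤⟨ ∑<-multiples (suc m) l (λ i → g (L + i)) ⟩
      ∑< (suc m * L) (λ i → g (L + i))                 ∎

theorem1 : (l n : ℕ) → a (suc l * suc n) ≥ a (suc l) * a (suc n)
theorem1 l n = subst (λ k → a (suc l) * a (suc n) ≤ a k) (*-comm (suc n) (suc l)) (a-superMultiplicative l n)
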